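{- Let $G$ be a connected directed planar graph such that (1) $\deg(v)=5$ for all $v\in V(G)$, (2) $\chi(v_1,v_1)=\chi(v_2,v_2)$ for all $v_1,v_2\in V(G)$, and (3) $\chi(v_1,w_1)=\chi(v_2,w_2)$ for all $(v_1,w_1),(v_2,w_2)\in E(G)$, where $\chi$ is the stable $2$-WL coloring of $G$. Then $G$ is isomorphic to the graph of an icosahedron.
   Context: For a directed graph, $N(v)=\{w:(v,w)\in E\text{ or }(w,v)\in E\}$ and $\deg(v)=|N(v)|$. An undirected graph is identified with the directed graph containing both orientations of each edge. 2-WL on $G$: initially $\chi^0(v_1,v_2)=\chi^0(w_1,w_2)$ iff ($v_1=v_2\Leftrightarrow w_1=w_2$) and for all $i,j\in\{1,2\}$ ($(v_i,v_j)\in E\Leftrightarrow(w_i,w_j)\in E$); then $\chi^{r+1}(v_1,v_2)=\big(\chi^r(v_1,v_2),\{\!\{(\chi^r(u,v_2),\chi^r(v_1,u)) : u\in V(G)\}\!\}\big)$ until stable. -}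

module Defs where

open import Data.Nat using (ℕ; zero; suc; _+_; _*_; _<_; _≡ᵇ_)
open import Data.Bool using (Bool; true; false; _∨_; _∧_; not; if_then_else_)
open import Data.Fin using (Fin; toℕ)
open import Data.List using (List; []; _∷_; map; allFin)
open import Data.Nat.ListAction using (sum)
open import Data.Bool.ListAction using (any)
open import Data.Product using (Σ; ∃; _×_; _,_)
open import Data.Sum using (_⊎_)
open import Function.Bundles using (_⇔_)
open import Data.Fin.Permutation using (Permutation; Permutation′; _⟨$⟩ʳ_)
open import Relation.Binary.PropositionalEquality using (_≡_)

Digraph : ℕ → Set
Digraph n = Fin n → Fin n → Bool

count : ∀ {n} → (Fin n → Bool) → ℕ
count {n} p = sum (map (λ w → if p w then 1 else 0) (allFin n))

nbr : ∀ {n} → Digraph n → Fin n → Fin n → Bool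
nbr E v w = E v w ∨ E w v

deg : ∀ {n} → Digraph n → Fin n → ℕ
deg E v = count (nbr E v)

_^[_] : ∀ {A : Set} → (A → A) → ℕ → A → A
(f ^[ zero ]) x = x
(f ^[ suc k ]) x = f ((f ^[ k ]) x)

-- Connectivity (weak connectivity: paths in the underlying undirected
-- graph); connected graphs are nonempty.

data Reach {n} (E : Digraph n) : Fin n → Fin n → Set where
  here : ∀ {v} → Reach E v v
  step : ∀ {u v w} → nbr E u v ≡ true → Reach E v w → Reach E u w

Connected : ∀ {n} → Digraph n → Set
Connected {n} E = (0 < n) × (∀ v w → Reach E v w)

-- 2-WL.  WL r E (v1 , v2) (w1 , w2) means χ^r(v1,v2) = χ^r(w1,w2).
-- Equality of multisets {{(χ^r(u,v2), χ^r(v1,u)) : u}} is witnessed by a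
-- bijection π of V(G) matching the multiset elements.

WL : ∀ {n} → ℕ → Digraph n → (Fin n × Fin n) → (Fin n × Fin n) → Set
WL zero E (v1 , v2) (w1 , w2) =
  ((v1 ≡ v2) ⇔ (w1 ≡ w2)) ×
  (E v1 v1 ≡ E w1 w1) × (E v1 v2 ≡ E w1 w2) ×
  (E v2 v1 ≡ E w2 w1) × (E v2 v2 ≡ E w2 w2)
WL {n} (suc r) E (v1 , v2) (w1 , w2) =
  WL r E (v1 , v2) (w1 , w2) ×
  Σ (Permutation′ n) λ π → ∀ u →
    WL r E (u , v2) (π ⟨$⟩ʳ u , w2) × WL r E (v1 , u) (w1 , π ⟨$⟩ʳ u)

-- χ(p) = χ(q) for the stable 2-WL colouring χ.  Since each round refines
-- the previous one and the colouring stabilises, this is equality at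
-- every round.
StableEq : ∀ {n} → Digraph n → (Fin n × Fin n) → (Fin n × Fin n) → Set
StableEq E p q = ∀ r → WL r E p q

-- Planarity (combinatorial, for connected graphs), via rotation systems
-- of the underlying simple undirected graph and Euler's formula
-- V - E + F = 2.

sadj : ∀ {n} → Digraph n → Fin n → Fin n → Bool
sadj E v w = nbr E v w ∧ not (toℕ v ≡ᵇ toℕ w)

-- number of darts = 2 * number of undirected edges
darts : ∀ {n} → Digraph n → ℕ
darts {n} E = sum (map (λ v → count (sadj E v)) (allFin n))

IsRotation : ∀ {n} → Digraph n → (Fin n → Fin n → Fin n) → Set
IsRotation E ρ =
  (∀ v w → sadj E v w ≡ true → sadj E v (ρ v w) ≡ true) ×
  (∀ v w w' → sadj E v w ≡ true → sadj E v w' ≡ true →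
     ∃ λ k → (ρ v ^[ k ]) w ≡ w')

faceStep : ∀ {n} → (Fin n → Fin n → Fin n) → (Fin n × Fin n) → (Fin n × Fin n)
faceStep ρ (v , w) = (w , ρ w v)

IsDart : ∀ {n} → Digraph n → (Fin n × Fin n) → Set
IsDart E (v , w) = sadj E v w ≡ true

FaceLabelling : ∀ {n} → Digraph n → (Fin n → Fin n → Fin n) → (F : ℕ) →
                ((Fin n × Fin n) → Fin F) → Set
FaceLabelling E ρ F face =
  (∀ d → IsDart E d → face (faceStep ρ d) ≡ face d) ×
  (∀ i → ∃ λ d → IsDart E d × face d ≡ i) ×
  (∀ d d' → IsDart E d → IsDart E d' → face d ≡ face d' →
     ∃ λ k → (faceStep ρ ^[ k ]) d ≡ d')

-- A (connected) graph is planar iff it has no edges, or it admits a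
-- rotation system whose number F of faces satisfies V - E + F = 2,
-- written as 2V + 2F = (#darts) + 4.
Planar : ∀ {n} → Digraph n → Set
Planar {n} E =
  (darts E ≡ 0) ⊎
  (Σ (Fin n → Fin n → Fin n) λ ρ → IsRotation E ρ ×
     Σ ℕ λ F → Σ ((Fin n × Fin n) → Fin F) λ face →
       FaceLabelling E ρ F face × (2 * n + 2 * F ≡ darts E + 4))

-- The icosahedron graph on Fin 12: 0 top, 1..5 upper ring,
-- 6..10 lower ring, 11 bottom.

icoEdges : List (ℕ × ℕ)
icoEdges =
  (0 , 1) ∷ (0 , 2) ∷ (0 , 3) ∷ (0 , 4) ∷ (0 , 5) ∷
  (1 , 2) ∷ (2 , 3) ∷ (3 , 4) ∷ (4 , 5) ∷ (5 , 1) ∷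
  (1 , 6) ∷ (1 , 7) ∷ (2 , 7) ∷ (2 , 8) ∷ (3 , 8) ∷
  (3 , 9) ∷ (4 , 9) ∷ (4 , 10) ∷ (5 , 10) ∷ (5 , 6) ∷
  (6 , 7) ∷ (7 , 8) ∷ (8 , 9) ∷ (9 , 10) ∷ (10 , 6) ∷
  (6 , 11) ∷ (7 , 11) ∷ (8 , 11) ∷ (9 , 11) ∷ (10 , 11) ∷ []

icosahedron : Digraph 12
icosahedron i j = any (λ { (a , b) → ((a ≡ᵇ toℕ i) ∧ (b ≡ᵇ toℕ j)) ∨
                                     ((b ≡ᵇ toℕ i) ∧ (a ≡ᵇ toℕ j)) }) icoEdges

Isomorphic : ∀ {n m} → Digraph n → Digraph m → Set
Isomorphic {n} {m} E E' =
  Σ (Permutation n m) λ f →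
    ∀ v w → E v w ≡ E' (f ⟨$⟩ʳ v) (f ⟨$⟩ʳ w)

-- The stable colouring makes E a simple 5-regular graph in which every edge lies in the same
-- number Λ of triangles: a loop or a one-way edge would get a colour different from the other
-- edges, and if all edges were one-way, in- and out-degree would both be constant and equal,
-- with sum 5. The link of each vertex is then a Λ-regular graph on five vertices: empty, a
-- pentagon or K₅. Faces of a simple graph have length at least 3, so Euler's formula gives at
-- least 12 vertices, ruling out K₅ links (they make E = K₆); empty links make E triangle-free,
-- hence all faces of length at least 4, which Euler's formula forbids. When all links are
-- pentagons, the wheels around adjacent vertices fit together as on the icosahedron, which
-- yields a covering map from the icosahedron onto the connected graph E, bijective because E
-- has at least 12 vertices.
module Submission where

open import Defs
import Data.Nat.Properties as ℕₚ
open import Data.Nat.Tactic.RingSolver using (solve-∀)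
open import Algebra.Properties.CommutativeMonoid.Sum ℕₚ.+-0-commutativeMonoid
  using (sum; sum-cong-≗; sum-permute; ∑-comm; ∑-distrib-+)
open import Data.Bool using (Bool; true; false; _∨_; _∧_; not; if_then_else_; T)
open import Data.Bool.Properties using (T-≡; ∨-idem; ∧-identityʳ; ∧-zeroʳ) renaming (_≟_ to _≟ᵇ_)
open import Data.Empty using (⊥; ⊥-elim)
open import Data.Fin using (Fin; zero; suc; toℕ; fromℕ<; combine; remQuot; punchOut)
open import Data.Fin.Patterns using (0F; 1F; 2F; 3F; 4F; 5F; 6F; 7F; 8F; 9F)
open import Data.Fin.Permutation using (Permutation′; _⟨$⟩ʳ_; permutation)
open import Data.Fin.Properties
  using ( _≟_; all?; any?; 0≢1+n; suc-injective; toℕ-injective; toℕ<n; nonZeroIndex; injective⇒≤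
        ; combine-injective; combine-remQuot; punchOut-injective)
import Data.List as List using (map; allFin; tabulate)
open import Data.List.Properties using (map-tabulate)
import Data.Nat.ListAction as List
open import Data.Nat using (ℕ; zero; suc; _+_; _*_; _∸_; _≤_; _≰_; _<_; z≤n; s≤s; _≡ᵇ_)
open import Data.Product using (∃; ∃₂; _×_; _,_; proj₁; proj₂; uncurry)
open import Data.Sum using (_⊎_; inj₁; inj₂)
open import Data.Vec using (Vec; []; _∷_; lookup; map; tabulate)
open import Data.Vec.Properties using (lookup-map; lookup∘tabulate)
open import Function using (_∘_; id; Equivalence)
open import Function.Definitions using (Injective)
open import Relation.Binary.Definitions using (tri<; tri≈; tri>)
open import Relation.Binary.PropositionalEquality
  using (_≡_; _≢_; _≗_; refl; sym; trans; cong; cong₂; subst; subst₂; module ≡-Reasoning)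
open import Relation.Nullary using (¬_; Dec; yes; no; does; isYes; ¬?)
open import Relation.Nullary.Decidable using (_×-dec_; _⊎-dec_; _→-dec_; map′; toWitness; from-yes; from-no)

∧-intro : ∀ {a b} → a ≡ true → b ≡ true → a ∧ b ≡ true
∧-intro refl refl = refl

∧-elimˡ : ∀ {a b} → a ∧ b ≡ true → a ≡ true
∧-elimˡ {true} _ = refl

∧-elimʳ : ∀ {a b} → a ∧ b ≡ true → b ≡ true
∧-elimʳ {true} b≡true = b≡true

∨-elim : ∀ {a b} → a ∨ b ≡ true → a ≡ true ⊎ b ≡ true
∨-elim {true}  _      = inj₁ refl
∨-elim {false} b≡true = inj₂ b≡true

bool-ext : ∀ {a b} → (a ≡ true → b ≡ true) → (b ≡ true → a ≡ true) → a ≡ b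
bool-ext {true}          a⇒b _   = sym (a⇒b refl)
bool-ext {false} {true}  _   b⇒a = b⇒a refl
bool-ext {false} {false} _   _   = refl

-- Counting over Fin n

indicator : Bool → ℕ
indicator b = if b then 1 else 0

size : ∀ {n} → (Fin n → Bool) → ℕ
size p = sum (indicator ∘ p)

sum-allFin : ∀ {n} (f : Fin n → ℕ) → List.sum (List.map f (List.allFin n)) ≡ sum f
sum-allFin f = trans (cong List.sum (map-tabulate id f)) (sum-tabulate f)
  where
  sum-tabulate : ∀ {n} (f : Fin n → ℕ) → List.sum (List.tabulate f) ≡ sum f
  sum-tabulate {zero}  f = refl
  sum-tabulate {suc n} f = cong (f zero +_) (sum-tabulate (f ∘ suc))

count≡size : ∀ {n} (p : Fin n → Bool) → count p ≡ size p
count≡size p = sum-allFin (indicator ∘ p)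

size-cong : ∀ {n} {p q : Fin n → Bool} → p ≗ q → size p ≡ size q
size-cong p≗q = sum-cong-≗ (cong indicator ∘ p≗q)

size-permute : ∀ {n} (p : Fin n → Bool) (π : Permutation′ n) → size p ≡ size (p ∘ (π ⟨$⟩ʳ_))
size-permute p π = sum-permute (indicator ∘ p) π

size-∨ : ∀ {n} (p q : Fin n → Bool) →
         size (λ u → p u ∨ q u) + size (λ u → p u ∧ q u) ≡ size p + size q
size-∨ p q = begin
  size (λ u → p u ∨ q u) + size (λ u → p u ∧ q u)
    ≡⟨ ∑-distrib-+ (indicator ∘ (λ u → p u ∨ q u)) (indicator ∘ (λ u → p u ∧ q u)) ⟨
  sum (λ u → indicator (p u ∨ q u) + indicator (p u ∧ q u))
    ≡⟨ sum-cong-≗ (λ u → pointwise (p u) (q u)) ⟩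
  sum (λ u → indicator (p u) + indicator (q u))
    ≡⟨ ∑-distrib-+ (indicator ∘ p) (indicator ∘ q) ⟩
  size p + size q
    ∎
  where
  open ≡-Reasoning
  pointwise : ∀ a b → indicator (a ∨ b) + indicator (a ∧ b) ≡ indicator a + indicator b
  pointwise true  true  = refl
  pointwise true  false = refl
  pointwise false true  = refl
  pointwise false false = refl

size-false : ∀ {n} (p : Fin n → Bool) → (∀ u → p u ≡ false) → size p ≡ 0
size-false {zero}  p p≡false = refl
size-false {suc n} p p≡false rewrite p≡false zero = size-false (p ∘ suc) (p≡false ∘ suc)

sum-const : ∀ n c → sum {n} (λ _ → c) ≡ n * c
sum-const zero    c = refl
sum-const (suc n) c = cong (c +_) (sum-const n c)

record Enumeration {n} (p : Fin n → Bool) (k : ℕ) : Set where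
  field
    elem           : Fin k → Fin n
    elem-holds     : ∀ i → p (elem i) ≡ true
    elem-injective : Injective _≡_ _≡_ elem
    index          : ∀ u → p u ≡ true → Fin k
    elem-index     : ∀ u (pu : p u ≡ true) → elem (index u pu) ≡ u

enumerate : ∀ {n} (p : Fin n → Bool) → Enumeration p (size p)
enumerate {zero}  p = record
  { elem = λ () ; elem-holds = λ () ; elem-injective = λ {} ; index = λ () ; elem-index = λ () }
enumerate {suc n} p with p zero in p0
... | true = record
  { elem = elem′ ; elem-holds = holds ; elem-injective = injective
  ; index = index′ ; elem-index = elem-index′ }
  where
  open Enumeration (enumerate (p ∘ suc))
  elem′ : Fin (suc (size (p ∘ suc))) → Fin (suc n)
  elem′ zero    = zero
  elem′ (suc i) = suc (elem i)
  holds : ∀ i → p (elem′ i) ≡ true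
  holds zero    = p0
  holds (suc i) = elem-holds i
  injective : Injective _≡_ _≡_ elem′
  injective {zero}  {zero}  _  = refl
  injective {suc i} {suc j} eq = cong suc (elem-injective (suc-injective eq))
  index′ : ∀ u → p u ≡ true → Fin (suc (size (p ∘ suc)))
  index′ zero    _  = zero
  index′ (suc u) pu = suc (index u pu)
  elem-index′ : ∀ u pu → elem′ (index′ u pu) ≡ u
  elem-index′ zero    _  = refl
  elem-index′ (suc u) pu = cong suc (elem-index u pu)
... | false = record
  { elem = suc ∘ elem ; elem-holds = elem-holds ; elem-injective = elem-injective ∘ suc-injective
  ; index = index′ ; elem-index = elem-index′ }
  where
  open Enumeration (enumerate (p ∘ suc))
  index′ : ∀ u → p u ≡ true → Fin (size (p ∘ suc))
  index′ zero pu with () ← trans (sym pu) p0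
  index′ (suc u) pu = index u pu
  elem-index′ : ∀ u pu → suc (elem (index′ u pu)) ≡ u
  elem-index′ zero pu with () ← trans (sym pu) p0
  elem-index′ (suc u) pu = cong suc (elem-index u pu)

module _ {n} {p : Fin n → Bool} where

  injection-≤-size : ∀ {m} (g : Fin m → Fin n) → Injective _≡_ _≡_ g → (∀ i → p (g i) ≡ true) →
                     m ≤ size p
  injection-≤-size {m} g g-injective g-holds = injective⇒≤ {f = index-g} index-g-injective
    where
    open Enumeration (enumerate p)
    index-g : Fin m → Fin (size p)
    index-g i = index (g i) (g-holds i)
    index-g-injective : Injective _≡_ _≡_ index-g
    index-g-injective {i} {j} eq = g-injective (begin
      g i                      ≡⟨ elem-index (g i) (g-holds i) ⟨
      elem (index-g i)         ≡⟨ cong elem eq ⟩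
      elem (index-g j)         ≡⟨ elem-index (g j) (g-holds j) ⟩
      g j                      ∎)
      where open ≡-Reasoning

  size-pos : ∀ {u} → p u ≡ true → 0 < size p
  size-pos {u} pu = injection-≤-size (λ _ → u) (λ { {zero} {zero} _ → refl }) (λ _ → pu)

  other-than : ∀ {k} → Enumeration p (suc (suc k)) → ∀ a → ∃ λ u → p u ≡ true × u ≢ a
  other-than en a = pick (elem 0F ≟ a)
    where
    open Enumeration en
    pick : Dec (elem 0F ≡ a) → ∃ λ u → p u ≡ true × u ≢ a
    pick (no  e₀≢a) = elem 0F , elem-holds 0F , e₀≢a
    pick (yes e₀≡a) = elem 1F , elem-holds 1F , λ e₁≡a → 0≢1+n (elem-injective (trans e₀≡a (sym e₁≡a)))

  size≡2-other-unique : size p ≡ 2 → ∀ {y w w′} → p y ≡ true → p w ≡ true → p w′ ≡ true →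
                        w ≢ y → w′ ≢ y → w ≡ w′
  size≡2-other-unique size≡2 {y} {w} {w′} py pw pw′ w≢y w′≢y with w ≟ w′
  ... | yes w≡w′ = w≡w′
  ... | no  w≢w′ = ⊥-elim (from-no (3 ℕₚ.≤? 2)
                     (subst (3 ≤_) size≡2 (injection-≤-size triple triple-injective triple-holds)))
    where
    triple : Fin 3 → Fin n
    triple = lookup (y ∷ w ∷ w′ ∷ [])
    triple-holds : ∀ i → p (triple i) ≡ true
    triple-holds 0F = py
    triple-holds 1F = pw
    triple-holds 2F = pw′
    triple-injective : Injective _≡_ _≡_ triple
    triple-injective {0F} {0F} _ = refl
    triple-injective {0F} {1F} eq = ⊥-elim (w≢y (sym eq))
    triple-injective {0F} {2F} eq = ⊥-elim (w′≢y (sym eq))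
    triple-injective {1F} {0F} eq = ⊥-elim (w≢y eq)
    triple-injective {1F} {1F} _ = refl
    triple-injective {1F} {2F} eq = ⊥-elim (w≢w′ eq)
    triple-injective {2F} {0F} eq = ⊥-elim (w′≢y eq)
    triple-injective {2F} {1F} eq = ⊥-elim (w≢w′ (sym eq))
    triple-injective {2F} {2F} _ = refl

size-restrict : ∀ {n k} {p q : Fin n → Bool} (en : Enumeration p k) →
                size (q ∘ Enumeration.elem en) ≡ size (λ u → p u ∧ q u)
size-restrict {p = p} {q} en = ℕₚ.≤-antisym
  (injection-≤-size (elem ∘ R.elem) (λ eq → R.elem-injective (elem-injective eq))
     (λ i → ∧-intro (elem-holds (R.elem i)) (R.elem-holds i)))
  (injection-≤-size (λ i → index (S.elem i) (∧-elimˡ (S.elem-holds i)))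
     (λ {i} {j} eq → S.elem-injective (begin
        S.elem i                                           ≡⟨ elem-index _ _ ⟨
        elem (index (S.elem i) (∧-elimˡ (S.elem-holds i))) ≡⟨ cong elem eq ⟩
        elem (index (S.elem j) (∧-elimˡ (S.elem-holds j))) ≡⟨ elem-index _ _ ⟩
        S.elem j                                           ∎))
     (λ i → trans (cong q (elem-index _ _)) (∧-elimʳ (S.elem-holds i))))
  where
  open Enumeration en
  module R = Enumeration (enumerate (q ∘ elem))
  module S = Enumeration (enumerate (λ u → p u ∧ q u))
  open ≡-Reasoning

product-injection-≤ : ∀ {a b c d} (h : Fin a × Fin b → Fin c × Fin d) → Injective _≡_ _≡_ h → a * b ≤ c * d
product-injection-≤ {a} {b} {c} {d} h h-injective = injective⇒≤ {f = f} f-injective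
  where
  f : Fin (a * b) → Fin (c * d)
  f x = uncurry combine (h (remQuot {a} b x))
  f-injective : Injective _≡_ _≡_ f
  f-injective {x} {y} eq with combine-injective _ _ _ _ eq
  ... | eq₁ , eq₂ = begin
    x                                 ≡⟨ combine-remQuot {a} b x ⟨
    uncurry combine (remQuot {a} b x) ≡⟨ cong (uncurry combine) (h-injective (cong₂ _,_ eq₁ eq₂)) ⟩
    uncurry combine (remQuot {a} b y) ≡⟨ combine-remQuot {a} b y ⟩
    y                                 ∎
    where open ≡-Reasoning

onto⇒≤ : ∀ {m n} (φ : Fin m → Fin n) → (∀ w → ∃ λ k → φ k ≡ w) → n ≤ m
onto⇒≤ φ onto = injective⇒≤ {f = proj₁ ∘ onto}
  (λ {v} {w} eq → trans (sym (proj₂ (onto v))) (trans (cong φ eq) (proj₂ (onto w))))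

injection-onto : ∀ {n m} (g : Fin n → Fin m) → Injective _≡_ _≡_ g → m ≤ n → ∀ i → ∃ λ y → g y ≡ i
injection-onto {n} {suc m} g g-injective m≤n i with any? (λ y → g y ≟ i)
... | yes found  = found
... | no  missed = ⊥-elim (ℕₚ.<-irrefl refl (ℕₚ.≤-trans m≤n (injective⇒≤ {f = g′} g′-injective)))
  where
  -- g misses i, so it factors through Fin m by removing i.
  g′ : Fin n → Fin m
  g′ y = punchOut {i = i} (λ i≡gy → missed (y , sym i≡gy))
  g′-injective : Injective _≡_ _≡_ g′
  g′-injective {x} {y} eq = g-injective (punchOut-injective {i = i} _ _ eq)

^[]-+ : ∀ {A : Set} (f : A → A) m k x → (f ^[ m + k ]) x ≡ (f ^[ m ]) ((f ^[ k ]) x)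
^[]-+ f zero    k x = refl
^[]-+ f (suc m) k x = cong f (^[]-+ f m k x)

^[]-fixed : ∀ {A : Set} {f : A → A} {x} → f x ≡ x → ∀ k → (f ^[ k ]) x ≡ x
^[]-fixed         fx≡x zero    = refl
^[]-fixed {f = f} fx≡x (suc k) = trans (cong f (^[]-fixed fx≡x k)) fx≡x

-- Euler's formula against face lengths

euler-faces≥3 : ∀ n F → F * 3 ≤ n * 5 → 2 * n + 2 * F ≡ n * 5 + 4 → 12 ≤ n
euler-faces≥3 n F faces euler = ℕₚ.+-cancelˡ-≤ (n * 15) 12 n (begin
  n * 15 + 12          ≡⟨ e₁ n ⟩
  3 * (n * 5 + 4)      ≡⟨ cong (3 *_) euler ⟨
  3 * (2 * n + 2 * F)  ≡⟨ e₂ n F ⟩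
  n * 6 + 2 * (F * 3)  ≤⟨ ℕₚ.+-monoʳ-≤ (n * 6) (ℕₚ.*-monoʳ-≤ 2 faces) ⟩
  n * 6 + 2 * (n * 5)  ≡⟨ e₃ n ⟩
  n * 15 + n           ∎)
  where
  open ℕₚ.≤-Reasoning
  e₁ : ∀ n → n * 15 + 12 ≡ 3 * (n * 5 + 4)
  e₁ = solve-∀
  e₂ : ∀ n F → 3 * (2 * n + 2 * F) ≡ n * 6 + 2 * (F * 3)
  e₂ = solve-∀
  e₃ : ∀ n → n * 6 + 2 * (n * 5) ≡ n * 15 + n
  e₃ = solve-∀

euler-faces≥4 : ∀ n F → F * 4 ≤ n * 5 → 2 * n + 2 * F ≢ n * 5 + 4
euler-faces≥4 n F faces euler = impossible (ℕₚ.+-cancelˡ-≤ (n * 18) (16 + n * 2) 0 (begin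
  n * 18 + (16 + n * 2) ≡⟨ e₁ n ⟩
  4 * (n * 5 + 4)       ≡⟨ cong (4 *_) euler ⟨
  4 * (2 * n + 2 * F)   ≡⟨ e₂ n F ⟩
  n * 8 + 2 * (F * 4)   ≤⟨ ℕₚ.+-monoʳ-≤ (n * 8) (ℕₚ.*-monoʳ-≤ 2 faces) ⟩
  n * 8 + 2 * (n * 5)   ≡⟨ e₃ n ⟩
  n * 18 + 0            ∎))
  where
  open ℕₚ.≤-Reasoning
  impossible : 16 + n * 2 ≰ 0
  impossible ()
  e₁ : ∀ n → n * 18 + (16 + n * 2) ≡ 4 * (n * 5 + 4)
  e₁ = solve-∀
  e₂ : ∀ n F → 4 * (2 * n + 2 * F) ≡ n * 8 + 2 * (F * 4)
  e₂ = solve-∀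
  e₃ : ∀ n → n * 8 + 2 * (n * 5) ≡ n * 18 + 0
  e₃ = solve-∀

-- What the stable 2-WL colouring sees

nbr-symmetric : ∀ {n} {E : Digraph n} → (∀ v w → E v w ≡ E w v) → ∀ v w → nbr E v w ≡ E v w
nbr-symmetric {E = E} symmetric v w = trans (cong (E v w ∨_) (symmetric w v)) (∨-idem (E v w))

module _ {n} {E : Digraph n} {v₁ w₁ v₂ w₂ : Fin n} (same : StableEq E (v₁ , w₁) (v₂ , w₂)) where

  stable-≡ : v₁ ≡ w₁ → v₂ ≡ w₂
  stable-≡ = Equivalence.to (proj₁ (same 0))

  stable-reverse : E w₁ v₁ ≡ E w₂ v₂
  stable-reverse = proj₁ (proj₂ (proj₂ (proj₂ (same 0))))

  -- One refinement round matches (E v₁ u , E u w₁) with (E v₂ (π u) , E (π u) w₂) for a permutation π.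
  stable-size : ∀ (f : Bool → Bool → Bool) →
                size (λ u → f (E v₁ u) (E u w₁)) ≡ size (λ u → f (E v₂ u) (E u w₂))
  stable-size f with same 1
  ... | _ , π , match = begin
    size (λ u → f (E v₁ u) (E u w₁))               ≡⟨ size-cong (λ u → cong₂ f (out u) (inc u)) ⟩
    size ((λ u → f (E v₂ u) (E u w₂)) ∘ (π ⟨$⟩ʳ_)) ≡⟨ size-permute (λ u → f (E v₂ u) (E u w₂)) π ⟨
    size (λ u → f (E v₂ u) (E u w₂))               ∎
    where
    open ≡-Reasoning
    out : ∀ u → E v₁ u ≡ E v₂ (π ⟨$⟩ʳ u)
    out u = proj₁ (proj₂ (proj₂ (proj₂ (match u))))
    inc : ∀ u → E u w₁ ≡ E (π ⟨$⟩ʳ u) w₂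
    inc u = proj₁ (proj₂ (proj₂ (proj₁ (match u))))

module StableColouring {n} (E : Digraph n) (v₀ : Fin n)
  (deg-5 : ∀ v → deg E v ≡ 5)
  (vertex-colour : ∀ v₁ v₂ → StableEq E (v₁ , v₁) (v₂ , v₂))
  (edge-colour : ∀ v₁ w₁ v₂ w₂ → E v₁ w₁ ≡ true → E v₂ w₂ ≡ true → StableEq E (v₁ , w₁) (v₂ , w₂))
  where

  neighbourhood : ∀ v → Enumeration (nbr E v) 5
  neighbourhood v = subst (Enumeration (nbr E v)) (trans (sym (count≡size (nbr E v))) (deg-5 v))
                          (enumerate (nbr E v))

  irreflexive : ∀ v → E v v ≡ false
  irreflexive v with E v v in loop
  ... | false = refl
  ... | true with other-than (neighbourhood v) v
  ... | w , v~w , w≢v with ∨-elim v~w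
  ...   | inj₁ vw = ⊥-elim (w≢v (sym (stable-≡ (edge-colour v v v w loop vw) refl)))
  ...   | inj₂ wv = ⊥-elim (w≢v (stable-≡ (edge-colour v v w v loop wv) refl))

  no-orientation : ¬ (∀ v w → E v w ≡ true → E w v ≡ false)
  no-orientation oriented = odd (outdeg v₀) (begin
    outdeg v₀ + outdeg v₀ ≡⟨ cong (outdeg v₀ +_) in≡out ⟨
    outdeg v₀ + indeg v₀  ≡⟨ out+in v₀ ⟩
    5                     ∎)
    where
    open ≡-Reasoning
    outdeg indeg : Fin n → ℕ
    outdeg v = size (E v)
    indeg v = size (λ u → E u v)
    out+in : ∀ v → outdeg v + indeg v ≡ 5
    out+in v = begin
      outdeg v + indeg v                          ≡⟨ size-∨ (E v) (λ u → E u v) ⟨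
      size (nbr E v) + size (λ u → E v u ∧ E u v) ≡⟨ cong₂ _+_ (sym (count≡size (nbr E v)))
                                                                (size-false _ one-way) ⟩
      deg E v + 0                                 ≡⟨ ℕₚ.+-identityʳ _ ⟩
      deg E v                                     ≡⟨ deg-5 v ⟩
      5                                           ∎
      where
      one-way : ∀ u → E v u ∧ E u v ≡ false
      one-way u with E v u in vu
      ... | true  = oriented v u vu
      ... | false = refl
    total : ∀ (degree : Fin n → ℕ) → (∀ v → degree v ≡ degree v₀) → sum degree ≡ n * degree v₀
    total degree const = trans (sum-cong-≗ const) (sum-const n (degree v₀))
    in≡out : indeg v₀ ≡ outdeg v₀
    in≡out = ℕₚ.*-cancelˡ-≡ (indeg v₀) (outdeg v₀) n {{nonZeroIndex v₀}} (begin
      n * indeg v₀                              ≡⟨ total indeg (λ v → stable-size (vertex-colour v v₀) λ _ in′ → in′) ⟨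
      sum indeg                                 ≡⟨ ∑-comm (λ v u → indicator (E v u)) ⟨
      sum (λ v → sum (λ u → indicator (E v u))) ≡⟨ total outdeg (λ v → stable-size (vertex-colour v v₀) λ out _ → out) ⟩
      n * outdeg v₀                             ∎)
    odd : ∀ d → d + d ≢ 5
    odd 0 ()
    odd 1 ()
    odd 2 ()
    odd (suc (suc (suc d))) eq =
      from-no (3 ℕₚ.≤? 2) (subst (3 ≤_) d+3+d≡2 (ℕₚ.≤-trans (ℕₚ.m≤m+n 3 d) (ℕₚ.m≤n+m (3 + d) d)))
      where
      d+3+d≡2 : d + suc (suc (suc d)) ≡ 2
      d+3+d≡2 = ℕₚ.suc-injective (ℕₚ.suc-injective (ℕₚ.suc-injective eq))

  reverse : ∀ {v w} → E v w ≡ true → E w v ≡ true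
  reverse {v} {w} vw with E w v in wv
  ... | true  = refl
  ... | false = ⊥-elim (no-orientation λ v′ w′ v′w′ →
                  trans (stable-reverse (edge-colour v′ w′ v w v′w′ vw)) wv)

  symmetric : ∀ v w → E v w ≡ E w v
  symmetric v w = bool-ext reverse reverse

  degree : ∀ v → size (E v) ≡ 5
  degree v = trans (size-cong (sym ∘ nbr-symmetric symmetric v)) (trans (sym (count≡size (nbr E v))) (deg-5 v))

  common-neighbours : ∀ {v w v′ w′} → E v w ≡ true → E v′ w′ ≡ true →
                      size (λ u → E v u ∧ E u w) ≡ size (λ u → E v′ u ∧ E u w′)
  common-neighbours {v} {w} {v′} {w′} vw v′w′ = stable-size (edge-colour v w v′ w′ vw v′w′) _∧_

-- Regular graphs on five vertices

fromUpperTriangle : Vec Bool 10 → Digraph 5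
fromUpperTriangle (a ∷ b ∷ c ∷ d ∷ e ∷ f ∷ g ∷ h ∷ i ∷ j ∷ []) x y = lookup (lookup rows x) y
  where
  rows : Vec (Vec Bool 5) 5
  rows = (false ∷ a     ∷ b     ∷ c     ∷ d     ∷ []) ∷
         (a     ∷ false ∷ e     ∷ f     ∷ g     ∷ []) ∷
         (b     ∷ e     ∷ false ∷ h     ∷ i     ∷ []) ∷
         (c     ∷ f     ∷ h     ∷ false ∷ j     ∷ []) ∷
         (d     ∷ g     ∷ i     ∷ j     ∷ false ∷ []) ∷ []

upperTriangle : Digraph 5 → Vec Bool 10
upperTriangle M = M 0F 1F ∷ M 0F 2F ∷ M 0F 3F ∷ M 0F 4F ∷ M 1F 2F ∷
                  M 1F 3F ∷ M 1F 4F ∷ M 2F 3F ∷ M 2F 4F ∷ M 3F 4F ∷ []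

fromUpperTriangle-upperTriangle : ∀ (M : Digraph 5) → (∀ i j → M i j ≡ M j i) → (∀ i → M i i ≡ false) →
                                  ∀ i j → fromUpperTriangle (upperTriangle M) i j ≡ M i j
fromUpperTriangle-upperTriangle M M-sym M-irr 0F 0F = sym (M-irr 0F)
fromUpperTriangle-upperTriangle M M-sym M-irr 0F 1F = refl
fromUpperTriangle-upperTriangle M M-sym M-irr 0F 2F = refl
fromUpperTriangle-upperTriangle M M-sym M-irr 0F 3F = refl
fromUpperTriangle-upperTriangle M M-sym M-irr 0F 4F = refl
fromUpperTriangle-upperTriangle M M-sym M-irr 1F 0F = M-sym 0F 1F
fromUpperTriangle-upperTriangle M M-sym M-irr 1F 1F = sym (M-irr 1F)
fromUpperTriangle-upperTriangle M M-sym M-irr 1F 2F = refl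
fromUpperTriangle-upperTriangle M M-sym M-irr 1F 3F = refl
fromUpperTriangle-upperTriangle M M-sym M-irr 1F 4F = refl
fromUpperTriangle-upperTriangle M M-sym M-irr 2F 0F = M-sym 0F 2F
fromUpperTriangle-upperTriangle M M-sym M-irr 2F 1F = M-sym 1F 2F
fromUpperTriangle-upperTriangle M M-sym M-irr 2F 2F = sym (M-irr 2F)
fromUpperTriangle-upperTriangle M M-sym M-irr 2F 3F = refl
fromUpperTriangle-upperTriangle M M-sym M-irr 2F 4F = refl
fromUpperTriangle-upperTriangle M M-sym M-irr 3F 0F = M-sym 0F 3F
fromUpperTriangle-upperTriangle M M-sym M-irr 3F 1F = M-sym 1F 3F
fromUpperTriangle-upperTriangle M M-sym M-irr 3F 2F = M-sym 2F 3F
fromUpperTriangle-upperTriangle M M-sym M-irr 3F 3F = sym (M-irr 3F)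
fromUpperTriangle-upperTriangle M M-sym M-irr 3F 4F = refl
fromUpperTriangle-upperTriangle M M-sym M-irr 4F 0F = M-sym 0F 4F
fromUpperTriangle-upperTriangle M M-sym M-irr 4F 1F = M-sym 1F 4F
fromUpperTriangle-upperTriangle M M-sym M-irr 4F 2F = M-sym 2F 4F
fromUpperTriangle-upperTriangle M M-sym M-irr 4F 3F = M-sym 3F 4F
fromUpperTriangle-upperTriangle M M-sym M-irr 4F 4F = sym (M-irr 4F)

next prev : Fin 5 → Fin 5
next 0F = 1F
next 1F = 2F
next 2F = 3F
next 3F = 4F
next 4F = 0F
prev 0F = 4F
prev 1F = 0F
prev 2F = 1F
prev 3F = 2F
prev 4F = 3F

lookup₅-cong : ∀ {A : Set} {a₀ a₁ a₂ a₃ a₄ b₀ b₁ b₂ b₃ b₄ : A} →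
               a₀ ≡ b₀ → a₁ ≡ b₁ → a₂ ≡ b₂ → a₃ ≡ b₃ → a₄ ≡ b₄ →
               lookup (a₀ ∷ a₁ ∷ a₂ ∷ a₃ ∷ a₄ ∷ []) ≗ lookup (b₀ ∷ b₁ ∷ b₂ ∷ b₃ ∷ b₄ ∷ [])
lookup₅-cong e₀ _  _  _  _  0F = e₀
lookup₅-cong _  e₁ _  _  _  1F = e₁
lookup₅-cong _  _  e₂ _  _  2F = e₂
lookup₅-cong _  _  _  e₃ _  3F = e₃
lookup₅-cong _  _  _  _  e₄ 4F = e₄

search : ∀ {n} → (Fin (suc n) → Bool) → Fin (suc n)
search {zero}  p = zero
search {suc n} p = if p zero then zero else suc (search (p ∘ suc))

walk : Digraph 5 → Fin 5 → Fin 5 → Fin 5 → Fin 5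
walk M a b i = proj₁ ((advance ^[ toℕ i ]) (a , b))
  where
  advance : Fin 5 × Fin 5 → Fin 5 × Fin 5
  advance (u , v) = v , search (λ w → M v w ∧ not (does (w ≟ u)))

IsPentagon : Digraph 5 → (Fin 5 → Fin 5) → Set
IsPentagon M c = (∀ i → M (c i) (c (next i)) ≡ true) × Injective _≡_ _≡_ c × (∀ u → ∃ λ i → c i ≡ u)

Regular : Digraph 5 → Set
Regular M = ∀ i → size (M i) ≡ size (M 0F)

Complete : Digraph 5 → Set
Complete M = ∀ i j → i ≢ j → M i j ≡ true

Shape : Digraph 5 → Set
Shape M = size (M 0F) ≡ 0
        ⊎ size (M 0F) ≡ 4 × Complete M
        ⊎ size (M 0F) ≡ 2 × (∀ a b → M a b ≡ true → IsPentagon M (walk M a b))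

module _ (M : Digraph 5) where

  regular? : Dec (Regular M)
  regular? = all? λ i → size (M i) ℕₚ.≟ size (M 0F)

  complete? : Dec (Complete M)
  complete? = all? λ i → all? λ j → ¬? (i ≟ j) →-dec M i j ≟ᵇ true

  pentagon? : ∀ c → Dec (IsPentagon M c)
  pentagon? c = all? (λ i → M (c i) (c (next i)) ≟ᵇ true)
          ×-dec map′ (λ inj {i} {j} → inj i j) (λ inj i j → inj) (all? λ i → all? λ j → c i ≟ c j →-dec i ≟ j)
          ×-dec all? (λ u → any? λ i → c i ≟ u)

  shape? : Dec (Shape M)
  shape? = size (M 0F) ℕₚ.≟ 0
     ⊎-dec size (M 0F) ℕₚ.≟ 4 ×-dec complete?
     ⊎-dec size (M 0F) ℕₚ.≟ 2 ×-dec all? λ a → all? λ b → M a b ≟ᵇ true →-dec pentagon? (walk M a b)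

allBits : ∀ k → (Vec Bool k → Bool) → Bool
allBits zero    f = f []
allBits (suc k) f = allBits k (f ∘ (true ∷_)) ∧ allBits k (f ∘ (false ∷_))

allBits-sound : ∀ k f → allBits k f ≡ true → ∀ v → f v ≡ true
allBits-sound zero    f all []          = all
allBits-sound (suc k) f all (true ∷ v)  = allBits-sound k (f ∘ (true ∷_)) (∧-elimˡ all) v
allBits-sound (suc k) f all (false ∷ v) =
  allBits-sound k (f ∘ (false ∷_)) (∧-elimʳ {allBits k (f ∘ (true ∷_))} all) v

-- By exhaustive check of all 2¹⁰ graphs.
regular-shape : ∀ v → Regular (fromUpperTriangle v) → Shape (fromUpperTriangle v)
regular-shape v = toWitness {a? = shape-of v} (Equivalence.from T-≡ (allBits-sound 10 (isYes ∘ shape-of) refl v))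
  where
  shape-of : ∀ v → Dec (Regular (fromUpperTriangle v) → Shape (fromUpperTriangle v))
  shape-of v = regular? (fromUpperTriangle v) →-dec shape? (fromUpperTriangle v)

-- The icosahedron

pattern 10F = suc 9F
pattern 11F = suc 10F

-- The neighbours of each vertex of the icosahedron, in cyclic order.
icoWheel : Fin 12 → Vec (Fin 12) 5
icoWheel 0F  = 1F ∷ 2F ∷ 3F  ∷ 4F  ∷ 5F  ∷ []
icoWheel 1F  = 5F ∷ 0F ∷ 2F  ∷ 7F  ∷ 6F  ∷ []
icoWheel 2F  = 1F ∷ 0F ∷ 3F  ∷ 8F  ∷ 7F  ∷ []
icoWheel 3F  = 2F ∷ 0F ∷ 4F  ∷ 9F  ∷ 8F  ∷ []
icoWheel 4F  = 3F ∷ 0F ∷ 5F  ∷ 10F ∷ 9F  ∷ []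
icoWheel 5F  = 4F ∷ 0F ∷ 1F  ∷ 6F  ∷ 10F ∷ []
icoWheel 6F  = 5F ∷ 1F ∷ 7F  ∷ 11F ∷ 10F ∷ []
icoWheel 7F  = 1F ∷ 2F ∷ 8F  ∷ 11F ∷ 6F  ∷ []
icoWheel 8F  = 2F ∷ 3F ∷ 9F  ∷ 11F ∷ 7F  ∷ []
icoWheel 9F  = 3F ∷ 4F ∷ 10F ∷ 11F ∷ 8F  ∷ []
icoWheel 10F = 4F ∷ 5F ∷ 6F  ∷ 11F ∷ 9F  ∷ []
icoWheel 11F = 7F ∷ 8F ∷ 9F  ∷ 10F ∷ 6F  ∷ []

icoWheel-adjacent : ∀ i j → icosahedron i (lookup (icoWheel i) j) ≡ true
icoWheel-adjacent = from-yes (all? λ i → all? λ j → icosahedron i (lookup (icoWheel i) j) ≟ᵇ true)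

adjacent-icoWheel : ∀ i k → icosahedron i k ≡ true → ∃ λ j → lookup (icoWheel i) j ≡ k
adjacent-icoWheel =
  from-yes (all? λ i → all? λ k → icosahedron i k ≟ᵇ true →-dec any? λ j → lookup (icoWheel i) j ≟ k)

-- Simple 5-regular graphs and their links

module FiveRegular {n} (E : Digraph n)
  (symmetric : ∀ v w → E v w ≡ E w v)
  (irreflexive : ∀ v → E v v ≡ false)
  (degree : ∀ v → size (E v) ≡ 5)
  where

  flip : ∀ {v w} → E v w ≡ true → E w v ≡ true
  flip {v} {w} vw = trans (symmetric w v) vw

  adjacent⇒≢ : ∀ {v w} → E v w ≡ true → v ≢ w
  adjacent⇒≢ {v} vw refl with () ← trans (sym vw) (irreflexive v)

  neighbours : ∀ x → Enumeration (E x) 5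
  neighbours x = subst (Enumeration (E x)) (degree x) (enumerate (E x))

  module _ (x : Fin n) where
    open Enumeration (neighbours x) public
      renaming (elem to nb; elem-holds to nb-adjacent; elem-injective to nb-injective;
                index to nb-index; elem-index to nb-nb-index)

  opaque
    -- The graph induced on the neighbourhood of x, read through its upper triangle so that
    -- regular-shape applies to it.
    link : Fin n → Digraph 5
    link x = fromUpperTriangle (upperTriangle (λ i j → E (nb x i) (nb x j)))

    link-≡ : ∀ x i j → link x i j ≡ E (nb x i) (nb x j)
    link-≡ x = fromUpperTriangle-upperTriangle (λ i j → E (nb x i) (nb x j))
                 (λ i j → symmetric (nb x i) (nb x j)) (λ i → irreflexive (nb x i))

    link-regular-shape : ∀ x → Regular (link x) → Shape (link x)
    link-regular-shape x = regular-shape _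

  record Wheel (x : Fin n) (c : Fin 5 → Fin n) : Set where
    field
      spoke     : ∀ i → E x (c i) ≡ true
      rim       : ∀ i → E (c i) (c (next i)) ≡ true
      injective : Injective _≡_ _≡_ c
      onto      : ∀ w → E x w ≡ true → ∃ λ i → c i ≡ w

  wheel-cong : ∀ {x c d} → c ≗ d → Wheel x c → Wheel x d
  wheel-cong {x} {c} {d} c≗d W = record
    { spoke     = λ i → subst (λ v → E x v ≡ true) (c≗d i) (spoke i)
    ; rim       = λ i → subst₂ (λ u v → E u v ≡ true) (c≗d i) (c≗d (next i)) (rim i)
    ; injective = λ {i} {j} eq → injective (trans (c≗d i) (trans eq (sym (c≗d j))))
    ; onto      = λ w xw → let i , ci≡w = onto w xw in i , trans (sym (c≗d i)) ci≡w
    }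
    where open Wheel W

  wheel-distinct : ∀ {x c} → Wheel x c → ∀ i j → i ≢ j → c i ≢ c j
  wheel-distinct W i j i≢j = i≢j ∘ Wheel.injective W

  link-pentagon-wheel : ∀ {x P} → IsPentagon (link x) P → Wheel x (nb x ∘ P)
  link-pentagon-wheel {x} {P} (rim , P-injective , P-onto) = record
    { spoke     = nb-adjacent x ∘ P
    ; rim       = λ i → trans (sym (link-≡ x (P i) (P (next i)))) (rim i)
    ; injective = P-injective ∘ nb-injective x
    ; onto      = λ w xw → let i , Pi≡ = P-onto (nb-index x w xw) in
                           i , trans (cong (nb x) Pi≡) (nb-nb-index x w xw)
    }

  sadj≡E : ∀ v w → sadj E v w ≡ E v w
  sadj≡E v w with toℕ v ≡ᵇ toℕ w in same
  ... | false = trans (∧-identityʳ (nbr E v w)) (nbr-symmetric symmetric v w)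
  ... | true with refl ← toℕ-injective (ℕₚ.≡ᵇ⇒≡ (toℕ v) (toℕ w) (subst T (sym same) _)) =
    trans (∧-zeroʳ (nbr E v v)) (sym (irreflexive v))

  darts≡ : darts E ≡ n * 5
  darts≡ = begin
    darts E                          ≡⟨ sum-allFin (λ v → count (sadj E v)) ⟩
    sum {n} (λ v → count (sadj E v)) ≡⟨ sum-cong-≗ (λ v → trans (count≡size (sadj E v))
                                                                (size-cong (sadj≡E v))) ⟩
    sum {n} (λ v → size (E v))       ≡⟨ sum-cong-≗ degree ⟩
    sum {n} (λ _ → 5)                ≡⟨ sum-const n 5 ⟩
    n * 5                            ∎
    where open ≡-Reasoning

  darts≢0 : Fin n → darts E ≢ 0
  darts≢0 v no-darts with () ← subst Fin (ℕₚ.m*n≡0⇒m≡0 n 5 (trans (sym darts≡) no-darts)) v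

  TriangleFree : Set
  TriangleFree = ∀ {a b c} → E a b ≡ true → E b c ≡ true → E c a ≡ true → ⊥

  module Embedding (ρ : Fin n → Fin n → Fin n) (rotation : IsRotation E ρ) where

    dart⇒edge : ∀ {v w} → IsDart E (v , w) → E v w ≡ true
    dart⇒edge {v} {w} = trans (sym (sadj≡E v w))

    edge⇒dart : ∀ {v w} → E v w ≡ true → IsDart E (v , w)
    edge⇒dart {v} {w} = trans (sadj≡E v w)

    faceStep^-dart : ∀ {d} → IsDart E d → ∀ k → IsDart E ((faceStep ρ ^[ k ]) d)
    faceStep^-dart d zero    = d
    faceStep^-dart d (suc k) = proj₁ rotation _ _ (edge⇒dart (flip (dart⇒edge (faceStep^-dart d k))))

    rotation-moves : ∀ {w v} → E w v ≡ true → ρ w v ≢ v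
    rotation-moves {w} {v} wv ρv≡v with other-than (neighbours w) v
    ... | c , wc , c≢v with proj₂ rotation w v c (edge⇒dart wv) (edge⇒dart wc)
    ...   | k , ρᵏv≡c = c≢v (trans (sym ρᵏv≡c) (^[]-fixed ρv≡v k))

    FaceLength≥ : ℕ → Set
    FaceLength≥ k = ∀ d → IsDart E d → ∀ m → 0 < m → m < k → proj₁ d ≢ proj₁ ((faceStep ρ ^[ m ]) d)

    faces≥3 : FaceLength≥ 3
    faces≥3 (a , b) ab 1 _ _ = adjacent⇒≢ (dart⇒edge ab)
    faces≥3 (a , b) ab 2 _ _ = rotation-moves (flip (dart⇒edge ab)) ∘ sym
    faces≥3 (a , b) ab (suc (suc (suc m))) _ (s≤s (s≤s (s≤s ())))

    faces≥4 : TriangleFree → FaceLength≥ 4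
    faces≥4 _            d ab 1 0<m _ = faces≥3 d ab 1 0<m (s≤s (s≤s z≤n))
    faces≥4 _            d ab 2 0<m _ = faces≥3 d ab 2 0<m ℕₚ.≤-refl
    faces≥4 triangle-free (a , b) ab 3 _ _ a≡e =
      triangle-free (dart⇒edge ab) (dart⇒edge (faceStep^-dart ab 1))
        (subst (λ e → E (ρ b a) e ≡ true) (sym a≡e) (dart⇒edge (faceStep^-dart ab 2)))
    faces≥4 _ d ab (suc (suc (suc (suc m)))) _ (s≤s (s≤s (s≤s (s≤s ()))))

    face-positions-apart : ∀ {k} → FaceLength≥ k → ∀ {d} → IsDart E d → ∀ {i j} → i < j → j < k →
                      proj₁ ((faceStep ρ ^[ i ]) d) ≢ proj₁ ((faceStep ρ ^[ j ]) d)
    face-positions-apart longer {d} dart {i} {j} i<j j<k eq =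
      longer ((faceStep ρ ^[ i ]) d) (faceStep^-dart dart i) (j ∸ i) (ℕₚ.m<n⇒0<n∸m i<j)
             (ℕₚ.≤-<-trans (ℕₚ.m∸n≤m j i) j<k) (trans eq (cong proj₁ walk-j))
      where
      walk-j : (faceStep ρ ^[ j ]) d ≡ (faceStep ρ ^[ j ∸ i ]) ((faceStep ρ ^[ i ]) d)
      walk-j = trans (cong (λ m → (faceStep ρ ^[ m ]) d) (sym (ℕₚ.m∸n+n≡m (ℕₚ.<⇒≤ i<j))))
                     (^[]-+ (faceStep ρ) (j ∸ i) i d)

    face-positions-injective : ∀ {k} → FaceLength≥ k → ∀ {d} → IsDart E d →
                          Injective _≡_ _≡_ (λ (j : Fin k) → proj₁ ((faceStep ρ ^[ toℕ j ]) d))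
    face-positions-injective longer dart {i} {j} eq with ℕₚ.<-cmp (toℕ i) (toℕ j)
    ... | tri< i<j _ _ = ⊥-elim (face-positions-apart longer dart i<j (toℕ<n j) eq)
    ... | tri≈ _ i≡j _ = toℕ-injective i≡j
    ... | tri> _ _ j<i = ⊥-elim (face-positions-apart longer dart j<i (toℕ<n i) (sym eq))

    face-along : ∀ {F face} → FaceLabelling E ρ F face → ∀ {d} → IsDart E d → ∀ k →
                face ((faceStep ρ ^[ k ]) d) ≡ face d
    face-along labelling dart zero    = refl
    face-along labelling dart (suc k) = trans (proj₁ labelling _ (faceStep^-dart dart k)) (face-along labelling dart k)

    -- Each face contributes k distinct darts, and there are n * 5 darts.
    faces-bound : ∀ {F face} → FaceLabelling E ρ F face → ∀ {k} → FaceLength≥ k → F * k ≤ n * 5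
    faces-bound {F} {face} labelling@(_ , representative , _) {k} longer =
      product-injection-≤ encode encode-injective
      where
      rep : Fin F → Fin n × Fin n
      rep f = proj₁ (representative f)
      rep-dart : ∀ f → IsDart E (rep f)
      rep-dart f = proj₁ (proj₂ (representative f))
      on-face : Fin F → Fin k → Fin n × Fin n
      on-face f j = (faceStep ρ ^[ toℕ j ]) (rep f)
      on-face-dart : ∀ f j → IsDart E (on-face f j)
      on-face-dart f j = faceStep^-dart (rep-dart f) (toℕ j)
      encode : Fin F × Fin k → Fin n × Fin 5
      encode (f , j) = proj₁ (on-face f j) , nb-index (proj₁ (on-face f j)) _ (dart⇒edge (on-face-dart f j))
      face-of : ∀ f j → face (on-face f j) ≡ f
      face-of f j = trans (face-along labelling (rep-dart f) (toℕ j)) (proj₂ (proj₂ (representative f)))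
      decode : Fin n × Fin 5 → Fin n × Fin n
      decode (v , i) = v , nb v i
      decode-encode : ∀ f j → decode (encode (f , j)) ≡ on-face f j
      decode-encode f j = cong (proj₁ (on-face f j) ,_) (nb-nb-index _ _ (dart⇒edge (on-face-dart f j)))
      same-dart : ∀ {f i f′ j} → encode (f , i) ≡ encode (f′ , j) → on-face f i ≡ on-face f′ j
      same-dart {f} {i} {f′} {j} eq = trans (sym (decode-encode f i)) (trans (cong decode eq) (decode-encode f′ j))
      encode-injective : Injective _≡_ _≡_ encode
      encode-injective {f , i} {f′ , j} eq
        with refl ← trans (sym (face-of f i)) (trans (cong face (same-dart {f} {i} {f′} {j} eq)) (face-of f′ j)) =
        cong (f ,_) (face-positions-injective longer (rep-dart f) (cong proj₁ (same-dart {f} {i} {f} {j} eq)))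

  planar⇒12≤n : Fin n → Planar E → 12 ≤ n
  planar⇒12≤n v (inj₁ no-darts) = ⊥-elim (darts≢0 v no-darts)
  planar⇒12≤n v (inj₂ (ρ , rotation , F , face , labelling , euler)) =
    euler-faces≥3 n F (faces-bound labelling faces≥3) (trans euler (cong (_+ 4) darts≡))
    where open Embedding ρ rotation

  triangle-free⇒nonplanar : Fin n → TriangleFree → ¬ Planar E
  triangle-free⇒nonplanar v _ (inj₁ no-darts) = darts≢0 v no-darts
  triangle-free⇒nonplanar v triangle-free (inj₂ (ρ , rotation , F , face , labelling , euler)) =
    euler-faces≥4 n F (faces-bound labelling (faces≥4 triangle-free)) (trans euler (cong (_+ 4) darts≡))
    where open Embedding ρ rotation

  closed-image-onto : (∀ v w → Reach E v w) → ∀ {m} (φ : Fin m → Fin n) →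
                      (∀ i w → E (φ i) w ≡ true → ∃ λ k → φ k ≡ w) → Fin m → ∀ w → ∃ λ k → φ k ≡ w
  closed-image-onto reach φ closed i₀ w = along (reach (φ i₀) w) (i₀ , refl)
    where
    along : ∀ {u w} → Reach E u w → ∃ (λ k → φ k ≡ u) → ∃ λ k → φ k ≡ w
    along here               image = image
    along (step {v = v} uv rest) (k , refl) = along rest (closed k v (trans (sym (nbr-symmetric symmetric _ v)) uv))

  -- Such a φ is a covering map, onto by connectivity and then bijective since 12 ≤ n.
  wheels⇒isomorphic : (∀ v w → Reach E v w) → 12 ≤ n → (φ : Fin 12 → Fin n) →
                      (∀ i → Wheel (φ i) (φ ∘ lookup (icoWheel i))) → Isomorphic E icosahedron
  wheels⇒isomorphic reach 12≤n φ wheel = permutation ψ φ ψφ φψ , λ v w →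
    trans (sym (cong₂ E (φψ v) (φψ w))) (preserves (ψ v) (ψ w))
    where
    onto : ∀ w → ∃ λ k → φ k ≡ w
    onto = closed-image-onto reach φ (λ i w φiw → let j , eq = Wheel.onto (wheel i) w φiw in
                                                   lookup (icoWheel i) j , eq) 0F
    ψ : Fin n → Fin 12
    ψ w = proj₁ (onto w)
    φψ : ∀ w → φ (ψ w) ≡ w
    φψ w = proj₂ (onto w)
    ψ-onto : ∀ i → ∃ λ w → ψ w ≡ i
    ψ-onto = injection-onto ψ (λ {v} {w} eq → trans (sym (φψ v)) (trans (cong φ eq) (φψ w))) 12≤n
    ψφ : ∀ i → ψ (φ i) ≡ i
    ψφ i = let w , ψw≡i = ψ-onto i in trans (cong (ψ ∘ φ) (sym ψw≡i)) (trans (cong ψ (φψ w)) ψw≡i)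
    preserves : ∀ i k → E (φ i) (φ k) ≡ icosahedron i k
    preserves i k = bool-ext
      (λ φiφk → let j , eq = Wheel.onto (wheel i) (φ k) φiφk in
                subst (λ k′ → icosahedron i k′ ≡ true)
                      (trans (sym (ψφ _)) (trans (cong ψ eq) (ψφ k))) (icoWheel-adjacent i j))
      (λ ik → let j , eq = adjacent-icoWheel i k ik in
              subst (λ k′ → E (φ i) (φ k′) ≡ true) eq (Wheel.spoke (wheel i) j))

  module CommonNeighbours (Λ : ℕ)
    (common : ∀ {v w} → E v w ≡ true → size (λ u → E v u ∧ E u w) ≡ Λ)
    where

    link-degree : ∀ x i → size (link x i) ≡ Λ
    link-degree x i = begin
      size (link x i)                           ≡⟨ size-cong (link-≡ x i) ⟩
      size (E (nb x i) ∘ nb x)                  ≡⟨ size-restrict (neighbours x) ⟩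
      size (λ u → E x u ∧ E (nb x i) u)         ≡⟨ size-cong (λ u → cong (E x u ∧_) (symmetric (nb x i) u)) ⟩
      size (λ u → E x u ∧ E u (nb x i))         ≡⟨ common (nb-adjacent x i) ⟩
      Λ                                         ∎
      where open ≡-Reasoning

    link-shape : ∀ x → Shape (link x)
    link-shape x = link-regular-shape x (λ i → trans (link-degree x i) (sym (link-degree x 0F)))

    Λ-cases : Fin n → Λ ≡ 0 ⊎ Λ ≡ 2 ⊎ Λ ≡ 4
    Λ-cases x with link-shape x
    ... | inj₁ deg≡0             = inj₁ (trans (sym (link-degree x 0F)) deg≡0)
    ... | inj₂ (inj₁ (deg≡4 , _)) = inj₂ (inj₂ (trans (sym (link-degree x 0F)) deg≡4))
    ... | inj₂ (inj₂ (deg≡2 , _)) = inj₂ (inj₁ (trans (sym (link-degree x 0F)) deg≡2))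

    Λ≡0⇒triangle-free : Λ ≡ 0 → TriangleFree
    Λ≡0⇒triangle-free Λ≡0 {a} {b} {c} ab bc ca with () ← subst (0 <_) (trans (common ab) Λ≡0)
                                                  (size-pos {p = λ u → E a u ∧ E u b} (∧-intro (flip ca) (flip bc)))

    link-complete : Λ ≡ 4 → ∀ {x a b} → E x a ≡ true → E x b ≡ true → a ≢ b → E a b ≡ true
    link-complete Λ≡4 {x} {a} {b} xa xb a≢b with link-shape x
    ... | inj₁ deg≡0 with () ← trans (sym deg≡0) (trans (link-degree x 0F) Λ≡4)
    ... | inj₂ (inj₂ (deg≡2 , _)) with () ← trans (sym deg≡2) (trans (link-degree x 0F) Λ≡4)
    ... | inj₂ (inj₁ (_ , complete)) = begin
      E a b                                     ≡⟨ cong₂ E (nb-nb-index x a xa) (nb-nb-index x b xb) ⟨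
      E (nb x (nb-index x a xa)) (nb x (nb-index x b xb)) ≡⟨ link-≡ x _ _ ⟨
      link x (nb-index x a xa) (nb-index x b xb) ≡⟨ complete _ _ (λ eq → a≢b (begin
        a                       ≡⟨ nb-nb-index x a xa ⟨
        nb x (nb-index x a xa)  ≡⟨ cong (nb x) eq ⟩
        nb x (nb-index x b xb)  ≡⟨ nb-nb-index x b xb ⟩
        b                       ∎)) ⟩
      true                                      ∎
      where open ≡-Reasoning

    Λ≡4⇒n≤6 : Λ ≡ 4 → (∀ v w → Reach E v w) → Fin n → n ≤ 6
    Λ≡4⇒n≤6 Λ≡4 reach x = onto⇒≤ ψ (closed-image-onto reach ψ closed 0F)
      where
      ψ : Fin 6 → Fin n
      ψ zero    = x
      ψ (suc i) = nb x i
      -- A neighbour w ≠ x of nb x i is adjacent to x since the link of nb x i is complete.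
      closed : ∀ i w → E (ψ i) w ≡ true → ∃ λ k → ψ k ≡ w
      closed zero    w xw = suc (nb-index x w xw) , nb-nb-index x w xw
      closed (suc i) w yw with w ≟ x
      ... | yes w≡x = zero , sym w≡x
      ... | no  w≢x = suc (nb-index x w xw) , nb-nb-index x w xw
        where
        xw : E x w ≡ true
        xw = link-complete Λ≡4 (flip (nb-adjacent x i)) yw (w≢x ∘ sym)

    link-pentagonal : Λ ≡ 2 → ∀ x a b → link x a b ≡ true → IsPentagon (link x) (walk (link x) a b)
    link-pentagonal Λ≡2 x a b ab with link-shape x
    ... | inj₁ deg≡0 with () ← trans (sym deg≡0) (trans (link-degree x 0F) Λ≡2)
    ... | inj₂ (inj₁ (deg≡4 , _)) with () ← trans (sym deg≡4) (trans (link-degree x 0F) Λ≡2)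
    ... | inj₂ (inj₂ (_ , pentagonal)) = pentagonal a b ab

    -- w continues the path y, z around x.
    Step : Fin n → Fin n → Fin n → Fin n → Set
    Step x y z w = E x w ≡ true × E z w ≡ true × w ≢ y

    module PentagonalLinks (Λ≡2 : Λ ≡ 2) where

      common-pair : ∀ {x z} → E x z ≡ true → Enumeration (λ u → E x u ∧ E u z) 2
      common-pair {x} {z} xz = subst (Enumeration _) (trans (common xz) Λ≡2) (enumerate _)

      step-unique : ∀ {x y z w w′} → E x z ≡ true → E x y ≡ true → E z y ≡ true →
                    Step x y z w → Step x y z w′ → w ≡ w′
      step-unique {x} {y} {z} xz xy zy (xw , zw , w≢y) (xw′ , zw′ , w′≢y) =
        size≡2-other-unique {p = λ u → E x u ∧ E u z} (trans (common xz) Λ≡2)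
          (∧-intro xy (flip zy)) (∧-intro xw (flip zw)) (∧-intro xw′ (flip zw′)) w≢y w′≢y

      step? : ∀ x y z w → Dec (Step x y z w)
      step? x y z w = E x w ≟ᵇ true ×-dec E z w ≟ᵇ true ×-dec ¬? (w ≟ y)

      third : Fin n → Fin n → Fin n → Fin n
      third x y z with any? (step? x y z)
      ... | yes (w , _) = w
      ... | no  _       = x

      third-step : ∀ {x y z} → E x z ≡ true → Step x y z (third x y z)
      third-step {x} {y} {z} xz with any? (step? x y z)
      ... | yes (_ , found) = found
      ... | no  none with other-than (common-pair xz) y
      ...   | w , xwz , w≢y = ⊥-elim (none (w , ∧-elimˡ xwz , flip (∧-elimʳ xwz) , w≢y))

      wheel-through : ∀ {x y₀ y₁} → E x y₀ ≡ true → E x y₁ ≡ true → E y₀ y₁ ≡ true →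
                      ∃₂ λ c₂ c₃ → ∃ λ c₄ → Wheel x (lookup (y₀ ∷ y₁ ∷ c₂ ∷ c₃ ∷ c₄ ∷ []))
      wheel-through {x} {y₀} {y₁} xy₀ xy₁ y₀y₁ =
        c 2F , c 3F , c 4F ,
        wheel-cong (λ i → trans (sym (lookup∘tabulate c i))
                                (lookup₅-cong (nb-nb-index x y₀ xy₀) (nb-nb-index x y₁ xy₁) refl refl refl i))
                   (link-pentagon-wheel (link-pentagonal Λ≡2 x i₀ i₁ i₀i₁))
        where
        i₀ i₁ : Fin 5
        i₀ = nb-index x y₀ xy₀
        i₁ = nb-index x y₁ xy₁
        c : Fin 5 → Fin n
        c = nb x ∘ walk (link x) i₀ i₁
        i₀i₁ : link x i₀ i₁ ≡ true
        i₀i₁ = trans (link-≡ x i₀ i₁) (trans (cong₂ E (nb-nb-index x y₀ xy₀) (nb-nb-index x y₁ xy₁)) y₀y₁)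

      -- The wheel around x is determined by y₀ and its two neighbours y₁, y₄ on the rim.
      wheel : ∀ {x y₀ y₁ y₂ y₄} → E x y₀ ≡ true → E x y₁ ≡ true → E y₀ y₁ ≡ true →
              Step x y₀ y₁ y₂ → Step x y₁ y₀ y₄ →
              Wheel x (lookup (y₀ ∷ y₁ ∷ y₂ ∷ third x y₁ y₂ ∷ y₄ ∷ []))
      wheel {x} {y₀} {y₁} {y₂} {y₄} xy₀ xy₁ y₀y₁ s₂@(xy₂ , _) s₄ with wheel-through xy₀ xy₁ y₀y₁
      ... | c₂ , c₃ , c₄ , W = wheel-cong (lookup₅-cong refl refl c₂≡y₂ c₃≡third c₄≡y₄) W
        where
        open Wheel W
        c₂≡y₂ : c₂ ≡ y₂
        c₂≡y₂ = step-unique xy₁ xy₀ (flip y₀y₁) (spoke 2F , rim 1F , wheel-distinct W 2F 0F λ ()) s₂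
        c₃≡third : c₃ ≡ third x y₁ y₂
        c₃≡third = step-unique xy₂ xy₁ (flip (subst (λ v → E y₁ v ≡ true) c₂≡y₂ (rim 1F)))
                     (spoke 3F , subst (λ v → E v c₃ ≡ true) c₂≡y₂ (rim 2F) , wheel-distinct W 3F 1F λ ())
                     (third-step xy₂)
        c₄≡y₄ : c₄ ≡ y₄
        c₄≡y₄ = step-unique xy₀ xy₁ y₀y₁ (spoke 4F , flip (rim 4F) , wheel-distinct W 4F 1F λ ()) s₄

      step-swap : ∀ {x y z w} → Step x y z w → Step z y x w
      step-swap (xw , zw , w≢y) = zw , xw , w≢y

      upper-wheel : ∀ {x p q r} → E x p ≡ true → E x q ≡ true → E x r ≡ true →
                    E p q ≡ true → E q r ≡ true → p ≢ r →
                    Wheel q (lookup (p ∷ x ∷ r ∷ third q x r ∷ third p x q ∷ []))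
      upper-wheel xp xq xr pq qr p≢r =
        wheel (flip pq) (flip xq) (flip xp) (qr , xr , p≢r ∘ sym) (step-swap (third-step pq))

      lower-wheel : ∀ {t p p′ q r bp bp′ bq} →
                    Wheel q (lookup (p ∷ t ∷ r ∷ bq ∷ bp ∷ [])) →
                    Wheel p (lookup (p′ ∷ t ∷ q ∷ bp ∷ bp′ ∷ [])) →
                    Wheel bp (lookup (p ∷ q ∷ bq ∷ third bp q bq ∷ bp′ ∷ []))
      lower-wheel Wq Wp =
        wheel (flip (Wp.spoke 3F)) (flip (Wq.spoke 4F)) (flip (Wq.spoke 0F))
              (flip (Wq.rim 3F) , Wq.spoke 3F , wheel-distinct Wq 3F 0F λ ())
              (Wp.rim 3F , Wp.spoke 4F , wheel-distinct Wp 4F 2F λ ())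
        where
        module Wq = Wheel Wq
        module Wp = Wheel Wp

      lower-wheels-meet : ∀ {p p′ q bp bp′ bp″ bq z z′} →
                          Wheel bp (lookup (p ∷ q ∷ bq ∷ z ∷ bp′ ∷ [])) →
                          Wheel bp′ (lookup (p′ ∷ p ∷ bp ∷ z′ ∷ bp″ ∷ [])) → z ≡ z′
      lower-wheels-meet W W′ =
        step-unique (W.spoke 4F) (W.spoke 0F) (W′.spoke 1F)
          (W.spoke 3F , flip (W.rim 3F) , wheel-distinct W 3F 0F λ ())
          (W′.rim 2F , W′.spoke 3F , wheel-distinct W′ 3F 1F λ ())
        where
        module W = Wheel W
        module W′ = Wheel W′

      module Icosahedron (t : Fin n) where

        -- t, the pentagon a, the pentagon b (b i is adjacent to a i and a (next i)) and the
        -- vertex z 0F are the four layers of the icosahedron.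
        a₀ a₁ : Fin n
        a₀ = nb t 0F
        a₁ = third t a₀ a₀

        a b z : Fin 5 → Fin n
        a = lookup (a₀ ∷ a₁ ∷ third t a₀ a₁ ∷ third t a₁ (third t a₀ a₁) ∷ third t a₁ a₀ ∷ [])
        b i = third (a i) t (a (next i))
        z i = third (b i) (a (next i)) (b (next i))

        top : Wheel t a
        top = wheel ta₀ ta₁ a₀a₁ (third-step ta₁) (third-step ta₀)
          where
          ta₀ : E t a₀ ≡ true
          ta₀ = nb-adjacent t 0F
          ta₁ : E t a₁ ≡ true
          ta₁ = proj₁ (third-step ta₀)
          a₀a₁ : E a₀ a₁ ≡ true
          a₀a₁ = proj₁ (proj₂ (third-step ta₀))

        module T = Wheel top

        upper : ∀ i → Wheel (a i) (lookup (a (prev i) ∷ t ∷ a (next i) ∷ b i ∷ b (prev i) ∷ []))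
        upper 0F = upper-wheel (T.spoke 4F) (T.spoke 0F) (T.spoke 1F) (T.rim 4F) (T.rim 0F) (wheel-distinct top 4F 1F λ ())
        upper 1F = upper-wheel (T.spoke 0F) (T.spoke 1F) (T.spoke 2F) (T.rim 0F) (T.rim 1F) (wheel-distinct top 0F 2F λ ())
        upper 2F = upper-wheel (T.spoke 1F) (T.spoke 2F) (T.spoke 3F) (T.rim 1F) (T.rim 2F) (wheel-distinct top 1F 3F λ ())
        upper 3F = upper-wheel (T.spoke 2F) (T.spoke 3F) (T.spoke 4F) (T.rim 2F) (T.rim 3F) (wheel-distinct top 2F 4F λ ())
        upper 4F = upper-wheel (T.spoke 3F) (T.spoke 4F) (T.spoke 0F) (T.rim 3F) (T.rim 4F) (wheel-distinct top 3F 0F λ ())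

        lower-with-z : ∀ i → Wheel (b i) (lookup (a i ∷ a (next i) ∷ b (next i) ∷ z i ∷ b (prev i) ∷ []))
        lower-with-z 0F = lower-wheel (upper 1F) (upper 0F)
        lower-with-z 1F = lower-wheel (upper 2F) (upper 1F)
        lower-with-z 2F = lower-wheel (upper 3F) (upper 2F)
        lower-with-z 3F = lower-wheel (upper 4F) (upper 3F)
        lower-with-z 4F = lower-wheel (upper 0F) (upper 4F)

        z-prev : ∀ i → z i ≡ z (prev i)
        z-prev 0F = lower-wheels-meet (lower-with-z 0F) (lower-with-z 4F)
        z-prev 1F = lower-wheels-meet (lower-with-z 1F) (lower-with-z 0F)
        z-prev 2F = lower-wheels-meet (lower-with-z 2F) (lower-with-z 1F)
        z-prev 3F = lower-wheels-meet (lower-with-z 3F) (lower-with-z 2F)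
        z-prev 4F = lower-wheels-meet (lower-with-z 4F) (lower-with-z 3F)

        z-const : ∀ i → z i ≡ z 0F
        z-const 0F = refl
        z-const 1F = z-prev 1F
        z-const 2F = trans (z-prev 2F) (z-prev 1F)
        z-const 3F = trans (z-prev 3F) (z-const 2F)
        z-const 4F = sym (z-prev 0F)

        lower : ∀ i → Wheel (b i) (lookup (a i ∷ a (next i) ∷ b (next i) ∷ z 0F ∷ b (prev i) ∷ []))
        lower i = wheel-cong (lookup₅-cong refl refl refl (z-const i) refl) (lower-with-z i)

        bottom : Wheel (z 0F) (lookup (b 0F ∷ b 1F ∷ b 2F ∷ b 3F ∷ b 4F ∷ []))
        bottom = wheel-cong (lookup₅-cong refl refl refl third≡b₃ refl)
                   (wheel (flip (L₀.spoke 3F)) (flip (L₁.spoke 3F)) (L₀.spoke 2F)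
                     (flip (L₂.spoke 3F) , L₁.spoke 2F , wheel-distinct (lower 1F) 2F 4F λ ())
                     (flip (L₄.spoke 3F) , L₀.spoke 4F , wheel-distinct (lower 0F) 4F 2F λ ()))
          where
          module L₀ = Wheel (lower 0F)
          module L₁ = Wheel (lower 1F)
          module L₂ = Wheel (lower 2F)
          module L₃ = Wheel (lower 3F)
          module L₄ = Wheel (lower 4F)
          third≡b₃ : third (z 0F) (b 1F) (b 2F) ≡ b 3F
          third≡b₃ = step-unique (flip (L₂.spoke 3F)) (flip (L₁.spoke 3F)) (L₂.spoke 4F)
                       (third-step (flip (L₂.spoke 3F)))
                       (flip (L₃.spoke 3F) , L₂.spoke 2F , wheel-distinct (lower 2F) 2F 4F λ ())

        φ : Fin 12 → Fin n
        φ = lookup (t ∷ a 0F ∷ a 1F ∷ a 2F ∷ a 3F ∷ a 4F ∷ b 4F ∷ b 0F ∷ b 1F ∷ b 2F ∷ b 3F ∷ z 0F ∷ [])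

        φ-wheel : ∀ i → Wheel (φ i) (φ ∘ lookup (icoWheel i))
        φ-wheel i = wheel-cong (λ j → lookup-map j φ (icoWheel i)) (wheels i)
          where
          wheels : ∀ i → Wheel (φ i) (lookup (map φ (icoWheel i)))
          wheels 0F  = top
          wheels 1F  = upper 0F
          wheels 2F  = upper 1F
          wheels 3F  = upper 2F
          wheels 4F  = upper 3F
          wheels 5F  = upper 4F
          wheels 6F  = lower 4F
          wheels 7F  = lower 0F
          wheels 8F  = lower 1F
          wheels 9F  = lower 2F
          wheels 10F = lower 3F
          wheels 11F = bottom

        icosahedral : (∀ v w → Reach E v w) → 12 ≤ n → Isomorphic E icosahedron
        icosahedral reach 12≤n = wheels⇒isomorphic reach 12≤n φ φ-wheel

lemma12 : (n : ℕ) (E : Digraph n) →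
    Connected E → Planar E →
    (∀ v → deg E v ≡ 5) →
    (∀ v₁ v₂ → StableEq E (v₁ , v₁) (v₂ , v₂)) →
    (∀ v₁ w₁ v₂ w₂ → E v₁ w₁ ≡ true → E v₂ w₂ ≡ true →
       StableEq E (v₁ , w₁) (v₂ , w₂)) →
    Isomorphic E icosahedron
lemma12 n E (0<n , reach) planar deg-5 vertex-colour edge-colour = by-cases (Λ-cases v₀)
  where
  v₀ : Fin n
  v₀ = fromℕ< 0<n
  open StableColouring E v₀ deg-5 vertex-colour edge-colour
  open FiveRegular E symmetric irreflexive degree
  Λ : ℕ
  Λ = size (λ u → E v₀ u ∧ E u (nb v₀ 0F))
  open CommonNeighbours Λ (λ vw → common-neighbours vw (nb-adjacent v₀ 0F))
  by-cases : Λ ≡ 0 ⊎ Λ ≡ 2 ⊎ Λ ≡ 4 → Isomorphic E icosahedron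
  by-cases (inj₁ Λ≡0)        = ⊥-elim (triangle-free⇒nonplanar v₀ (Λ≡0⇒triangle-free Λ≡0) planar)
  by-cases (inj₂ (inj₁ Λ≡2)) = PentagonalLinks.Icosahedron.icosahedral Λ≡2 v₀ reach (planar⇒12≤n v₀ planar)
  by-cases (inj₂ (inj₂ Λ≡4)) = ⊥-elim (from-no (12 ℕₚ.≤? 6)
                                         (ℕₚ.≤-trans (planar⇒12≤n v₀ planar) (Λ≡4⇒n≤6 Λ≡4 reach v₀)))
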